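{- Let $C : \mathsf{Form} \to \mathsf{Prop}$ be any predicate on formulas. Let $\mathsf{Code}$ be any type and $\mathsf{eval} : \mathsf{Code} \to \mathsf{Code} \to \mathsf{Form}$ any function. Assume: (i) (evaluation completeness) for every function $f : \mathsf{Code} \to \mathsf{Form}$ there exists $c \in \mathsf{Code}$ such that for all $x \in \mathsf{Code}$, $\mathsf{eval}(c,x) \simeq_C f(x)$; (ii) (modus ponens) for all formulas $A,B$, if $C(A \to B)$ and $C(A)$ then $C(B)$; (iii) (consistency) $C(\bot)$ does not hold; (iv) (internal excluded middle) for every formula $A$, $C(A) \lor C(\neg A)$. Then a contradiction follows; i.e., (i)–(iv) cannot hold jointly.
   Context: $\mathsf{Form}$ is the type of closed formulas of the implication–falsity fragment, generated by $A,B ::= \bot \mid A \to B$ (finite trees over $\{\bot,\to\}$); $\neg A$ abbreviates $A \to \bot$. $C$ is an arbitrary predicate ("closure predicate") on $\mathsf{Form}$, and $C(A)$ is read "$C$ accepts $A$". Closure equivalence: $A \simeq_C B$ means $C(A \to B) \land C(B \to A)$. The reasoning takes place in a constructive metatheory. -}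

module Defs where

open import Data.Product using (_×_)

data Form : Set where
  ⊥f  : Form
  _⇒_ : Form → Form → Form

infixr 5 _⇒_

¬f : Form → Form
¬f A = A ⇒ ⊥f

_≃[_]_ : Form → (Form → Set) → Form → Set
A ≃[ C ] B = C (A ⇒ B) × C (B ⇒ A)

{-# OPTIONS --safe #-}
-- A diagonal argument: the code c representing x ↦ ¬(eval x x) gives a liar
-- sentence D = eval c c with D ≃ ¬D. Whichever of D, ¬D is accepted, modus
-- ponens across the equivalence yields both D and ¬D, hence ⊥.
module Submission where

open import Defs
open import Data.Empty using (⊥)
open import Data.Product using (Σ; _,_; swap)
open import Data.Sum using (_⊎_; inj₁; inj₂)
open import Relation.Nullary using (¬_)

≃-sym : {C : Form → Set} {A B : Form} → A ≃[ C ] B → B ≃[ C ] A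
≃-sym = swap

diagonal-fixpoint : (C : Form → Set) {Code : Set} (eval : Code → Code → Form)
  → ((f : Code → Form) → Σ Code (λ c → (x : Code) → eval c x ≃[ C ] f x))
  → (g : Form → Form) → Σ Form (λ D → D ≃[ C ] g D)
diagonal-fixpoint C eval complete g with complete (λ x → g (eval x x))
... | c , represents = eval c c , represents c

module _ {C : Form → Set} (mp : (A B : Form) → C (A ⇒ B) → C A → C B) where

  transport-≃ : {A B : Form} → A ≃[ C ] B → C A → C B
  transport-≃ (A⇒B , _) = mp _ _ A⇒B

  refute : {A : Form} → C A → C (¬f A) → C ⊥f
  refute {A} a ¬a = mp A ⊥f ¬a a

  liar-accepts-⊥ : {D : Form} → D ≃[ C ] ¬f D → C D ⊎ C (¬f D) → C ⊥f
  liar-accepts-⊥ D≃¬D (inj₁ d)  = refute d (transport-≃ D≃¬D d)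
  liar-accepts-⊥ D≃¬D (inj₂ ¬d) = refute (transport-≃ (≃-sym {C} D≃¬D) ¬d) ¬d

theorem3p9 : (C : Form → Set) (Code : Set) (eval : Code → Code → Form)
    → ((f : Code → Form) → Σ Code (λ c → (x : Code) → eval c x ≃[ C ] f x))
    → ((A B : Form) → C (A ⇒ B) → C A → C B)
    → ¬ C ⊥f
    → ((A : Form) → C A ⊎ C (¬f A))
    → ⊥
theorem3p9 C Code eval complete mp consistent em =
  let D , D≃¬D = diagonal-fixpoint C eval complete ¬f
  in consistent (liar-accepts-⊥ mp D≃¬D (em D))
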